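{- Let \[ A=\begin{bmatrix}1&1&1\\1&1&1\\1&1&1\end{bmatrix},\quad B=\begin{bmatrix}5&0&4\\2&3&4\\2&6&1\end{bmatrix},\quad C=\begin{bmatrix}2&0&1\\0&1&2\\1&2&0\end{bmatrix},\quad D=\begin{bmatrix}3&0&3\\2&2&2\\1&4&1\end{bmatrix}, \] \[ T_1=\begin{bmatrix}7&0&5\\2&4&6\\3&8&1\end{bmatrix},\quad T_2=\begin{bmatrix}8&0&7\\4&5&6\\3&10&2\end{bmatrix}. \] Every magic square of order three, up to rotation and reflection, can be written uniquely as either $T_1+iA+jB+kC$ or $T_2+iA+jB+kD$, where $i,j,k$ are nonnegative integers. That is, for every magic square $M$ of order $3$ there is exactly one choice of form (the $T_1$-form or the $T_2$-form) and of nonnegative integers $i,j,k$ such that $M$ is obtained from the corresponding matrix by a rotation or reflection of the $3\times 3$ array.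
   Context: A magic square of order $n$ is an $n\times n$ matrix with pairwise distinct nonnegative integer entries such that all $n$ row sums, all $n$ column sums, and the two diagonal sums are equal to the same number $m$ (the magic number). Rotations and reflections refer to the action of the dihedral group of order $8$ (symmetries of the square) on the positions of the $3\times 3$ array. -}

module Defs where

open import Data.Nat using (ℕ; _+_; _*_)
open import Data.Fin using (Fin; zero; suc)
open import Data.Bool using (Bool; true; false)
open import Data.Product using (_×_; _,_; Σ; ∃)
open import Relation.Binary.PropositionalEquality using (_≡_)

Matrix3 : Set
Matrix3 = Fin 3 → Fin 3 → ℕ

_≋_ : Matrix3 → Matrix3 → Set
M ≋ N = ∀ r c → M r c ≡ N r c

Distinct : Matrix3 → Set
Distinct M = ∀ r c r' c' → M r c ≡ M r' c' → (r ≡ r') × (c ≡ c')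

0F 1F 2F : Fin 3
0F = zero
1F = suc zero
2F = suc (suc zero)

rowSum : Matrix3 → Fin 3 → ℕ
rowSum M r = M r 0F + M r 1F + M r 2F

colSum : Matrix3 → Fin 3 → ℕ
colSum M c = M 0F c + M 1F c + M 2F c

diagSum antiDiagSum : Matrix3 → ℕ
diagSum M = M 0F 0F + M 1F 1F + M 2F 2F
antiDiagSum M = M 0F 2F + M 1F 1F + M 2F 0F

IsMagic : Matrix3 → Set
IsMagic M = Distinct M ×
  Σ ℕ λ m → (∀ r → rowSum M r ≡ m) × (∀ c → colSum M c ≡ m)
          × (diagSum M ≡ m) × (antiDiagSum M ≡ m)

-- Dihedral group of order 8 acting on positions: an element is
-- (swap?, reverse rows?, reverse columns?); these 8 position maps are
-- exactly the symmetries of the square.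
rev : Fin 3 → Fin 3
rev zero = 2F
rev (suc zero) = 1F
rev (suc (suc zero)) = 0F

D4 : Set
D4 = Bool × Bool × Bool

cond : Bool → (Fin 3 → Fin 3) → Fin 3 → Fin 3
cond true f x = f x
cond false f x = x

_•_ : D4 → Matrix3 → Matrix3
((true , a , b) • M) r c = M (cond a rev c) (cond b rev r)
((false , a , b) • M) r c = M (cond a rev r) (cond b rev c)

mat : ℕ → ℕ → ℕ → ℕ → ℕ → ℕ → ℕ → ℕ → ℕ → Matrix3
mat a b c d e f g h i zero zero = a
mat a b c d e f g h i zero (suc zero) = b
mat a b c d e f g h i zero (suc (suc zero)) = c
mat a b c d e f g h i (suc zero) zero = d
mat a b c d e f g h i (suc zero) (suc zero) = e
mat a b c d e f g h i (suc zero) (suc (suc zero)) = f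
mat a b c d e f g h i (suc (suc zero)) zero = g
mat a b c d e f g h i (suc (suc zero)) (suc zero) = h
mat a b c d e f g h i (suc (suc zero)) (suc (suc zero)) = i

A B C D T₁ T₂ : Matrix3
A  = mat 1 1 1  1 1 1  1 1 1
B  = mat 5 0 4  2 3 4  2 6 1
C  = mat 2 0 1  0 1 2  1 2 0
D  = mat 3 0 3  2 2 2  1 4 1
T₁ = mat 7 0 5  2 4 6  3 8 1
T₂ = mat 8 0 7  4 5 6  3 10 2

data Form : Set where
  form₁ form₂ : Form

param : Form → ℕ → ℕ → ℕ → Matrix3
param form₁ i j k r c = T₁ r c + i * A r c + j * B r c + k * C r c
param form₂ i j k r c = T₂ r c + i * A r c + j * B r c + k * D r c

Represents : Matrix3 → Form → ℕ → ℕ → ℕ → Set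
Represents M f i j k = ∃ λ (g : D4) → M ≋ (g • param f i j k)

{-# OPTIONS --safe #-}
-- The four lines through the centre e add up to the whole square plus 3e, so
-- the magic number is 3e and opposite cells sum to 2e. Hence exactly one corner
-- on each diagonal exceeds e, and a symmetry brings these two corners to the top
-- row, larger first: e + a on the left, e + b on the right, 0 < b < a. A square
-- with line sums is determined by its top row, so it is then Lucas's square
-- i A + a C + b V, and distinctness forces a ≠ 2b.
-- Since T₁ = 3C + V, B = 2C + V, T₂ = 3C + 2V and D = C + V, the first form is
-- exactly this square with a > 2b and the second the one with a < 2b.
-- Uniqueness: the centre and the unordered pair {a, b} of corner deviations from
-- it do not change under symmetries, and they determine i, a and b.
module Submission where

open import Defs
open import Data.Nat using (ℕ; zero; suc; z<s; _+_; _*_; _∸_; _<_; _≤_; _⊔_; _⊓_; ∣_-_∣)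
open import Data.Nat.Properties
open import Data.Nat.Tactic.RingSolver using (solve-∀)
open import Data.Bool using (true; false)
open import Data.Fin using (Fin; zero; suc)
open import Data.Product using (Σ; _×_; _,_; proj₁; proj₂; swap; map₁)
open import Data.Product.Properties using (,-injective)
open import Data.Sum using (_⊎_; inj₁; inj₂)
open import Function using (id)
open import Relation.Nullary using (contradiction)
open import Relation.Binary.Definitions using (tri<; tri≈; tri>)
open import Relation.Binary.PropositionalEquality
open ≡-Reasoning

≋-sym : ∀ {M N} → M ≋ N → N ≋ M
≋-sym M≋N r c = sym (M≋N r c)

≋-trans : ∀ {M N P} → M ≋ N → N ≋ P → M ≋ P
≋-trans M≋N N≋P r c = trans (M≋N r c) (N≋P r c)

entrywise : ∀ {M N} →
  M 0F 0F ≡ N 0F 0F → M 0F 1F ≡ N 0F 1F → M 0F 2F ≡ N 0F 2F →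
  M 1F 0F ≡ N 1F 0F → M 1F 1F ≡ N 1F 1F → M 1F 2F ≡ N 1F 2F →
  M 2F 0F ≡ N 2F 0F → M 2F 1F ≡ N 2F 1F → M 2F 2F ≡ N 2F 2F → M ≋ N
entrywise e₀₀ e₀₁ e₀₂ e₁₀ e₁₁ e₁₂ e₂₀ e₂₁ e₂₂ = λ where
  zero             zero             → e₀₀
  zero             (suc zero)       → e₀₁
  zero             (suc (suc zero)) → e₀₂
  (suc zero)       zero             → e₁₀
  (suc zero)       (suc zero)       → e₁₁
  (suc zero)       (suc (suc zero)) → e₁₂
  (suc (suc zero)) zero             → e₂₀
  (suc (suc zero)) (suc zero)       → e₂₁
  (suc (suc zero)) (suc (suc zero)) → e₂₂

≢-row : ∀ {M r c r' c'} → Distinct M → r ≢ r' → M r c ≢ M r' c'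
≢-row distinct r≢r' eq = r≢r' (proj₁ (distinct _ _ _ _ eq))

≢-col : ∀ {M r c r' c'} → Distinct M → c ≢ c' → M r c ≢ M r' c'
≢-col distinct c≢c' eq = c≢c' (proj₂ (distinct _ _ _ _ eq))

rev-involutive : ∀ x → rev (rev x) ≡ x
rev-involutive zero = refl
rev-involutive (suc zero) = refl
rev-involutive (suc (suc zero)) = refl

rev-injective : ∀ {x y} → rev x ≡ rev y → x ≡ y
rev-injective {x} {y} eq = trans (sym (rev-involutive x)) (trans (cong rev eq) (rev-involutive y))

cond-involutive : ∀ s x → cond s rev (cond s rev x) ≡ x
cond-involutive true = rev-involutive
cond-involutive false _ = refl

transpose reverseRows : Matrix3 → Matrix3
transpose M r c = M c r
reverseRows M r c = M (rev r) c

•-preserves : (P : Matrix3 → Set) →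
  (∀ {M} → P M → P (transpose M)) → (∀ {M} → P M → P (reverseRows M)) →
  ∀ g {M} → P M → P (g • M)
•-preserves P τ ρ = preserves
  where
  reflections : ∀ a b {M} → P M → P ((false , a , b) • M)
  reflections false false p = p
  reflections true false p = ρ p
  reflections false true p = τ (ρ (τ p))
  reflections true true p = ρ (τ (ρ (τ p)))

  preserves : ∀ g {M} → P M → P (g • M)
  preserves (true , a , b) p = τ (reflections a b p)
  preserves (false , a , b) p = reflections a b p

•-cong : ∀ g {M N} → M ≋ N → (g • M) ≋ (g • N)
•-cong (true , _ , _) M≋N r c = M≋N _ _
•-cong (false , _ , _) M≋N r c = M≋N _ _

centre-• : ∀ g {M} → (g • M) 1F 1F ≡ M 1F 1F
centre-• g {M} = •-preserves (λ X → X 1F 1F ≡ M 1F 1F) id id g refl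

infix 30 _⁻¹

_⁻¹ : D4 → D4
(true , a , b) ⁻¹ = true , b , a
(false , a , b) ⁻¹ = false , a , b

•-inverseˡ : ∀ g M → M ≋ (g ⁻¹ • (g • M))
•-inverseˡ (true , a , b) M r c = sym (cong₂ M (cond-involutive a r) (cond-involutive b c))
•-inverseˡ (false , a , b) M r c = sym (cong₂ M (cond-involutive a r) (cond-involutive b c))

reverse-sum : ∀ x y z {m} → x + y + z ≡ m → z + y + x ≡ m
reverse-sum x y z = trans (reversal x y z)
  where
  reversal : ∀ x y z → z + y + x ≡ x + y + z
  reversal = solve-∀

IsMagic-transpose : ∀ {M} → IsMagic M → IsMagic (transpose M)
IsMagic-transpose {M} (distinct , m , rows , cols , diag , anti) =
  (λ r c r' c' eq → swap (distinct c r c' r' eq)) , m ,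
  cols , rows , diag , reverse-sum (M 0F 2F) (M 1F 1F) (M 2F 0F) anti

IsMagic-reverseRows : ∀ {M} → IsMagic M → IsMagic (reverseRows M)
IsMagic-reverseRows {M} (distinct , m , rows , cols , diag , anti) =
  (λ r c r' c' eq → map₁ rev-injective (distinct _ _ _ _ eq)) , m ,
  (λ r → rows (rev r)) , (λ c → reverse-sum (M 0F c) (M 1F c) (M 2F c) (cols c)) ,
  reverse-sum (M 0F 2F) (M 1F 1F) (M 2F 0F) anti , reverse-sum (M 0F 0F) (M 1F 1F) (M 2F 2F) diag

IsMagic-• : ∀ g {M} → IsMagic M → IsMagic (g • M)
IsMagic-• = •-preserves IsMagic IsMagic-transpose IsMagic-reverseRows

HasLineSum : ℕ → Matrix3 → Set
HasLineSum m M =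
  (∀ r → rowSum M r ≡ m) × (∀ c → colSum M c ≡ m) × (diagSum M ≡ m) × (antiDiagSum M ≡ m)

magic-number : ∀ {m} M → HasLineSum m M → 3 * M 1F 1F ≡ m
magic-number {m} M (rows , cols , diag , anti) = +-cancelˡ-≡ (m + m + m) _ _ (begin
  m + m + m + 3 * M 1F 1F
    ≡⟨ cong (_+ 3 * M 1F 1F) (sym (cong₂ _+_ (cong₂ _+_ (rows 0F) (rows 1F)) (rows 2F))) ⟩
  rowSum M 0F + rowSum M 1F + rowSum M 2F + 3 * M 1F 1F
    ≡⟨ lines-through-centre (M 0F 0F) (M 0F 1F) (M 0F 2F) (M 1F 0F) (M 1F 1F) (M 1F 2F)
                            (M 2F 0F) (M 2F 1F) (M 2F 2F) ⟩
  rowSum M 1F + colSum M 1F + diagSum M + antiDiagSum M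
    ≡⟨ cong₂ _+_ (cong₂ _+_ (cong₂ _+_ (rows 1F) (cols 1F)) diag) anti ⟩
  m + m + m + m ∎)
  where
  lines-through-centre : ∀ p q r s e t u v w →
    (p + q + r) + (s + e + t) + (u + v + w) + 3 * e ≡ (s + e + t) + (q + e + v) + (p + e + w) + (r + e + u)
  lines-through-centre = solve-∀

opposite-cells : ∀ x e y {m} → x + e + y ≡ m → 3 * e ≡ m → x + y ≡ e + e
opposite-cells x e y line centre = +-cancelˡ-≡ e _ _ (begin
  e + (x + y)  ≡⟨ move-centre x e y ⟩
  x + e + y    ≡⟨ trans line (sym centre) ⟩
  3 * e        ≡⟨ cong (λ t → e + (e + t)) (+-identityʳ e) ⟩
  e + (e + e)  ∎)
  where
  move-centre : ∀ x e y → e + (x + y) ≡ x + e + y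
  move-centre = solve-∀

cancel-last : ∀ {x y z x' y' z'} → x ≡ x' → y ≡ y' → x + y + z ≡ x' + y' + z' → z ≡ z'
cancel-last {x} {y} refl refl = +-cancelˡ-≡ (x + y) _ _

cancel-middle : ∀ {x y z x' y' z'} → x ≡ x' → z ≡ z' → x + y + z ≡ x' + y' + z' → y ≡ y'
cancel-middle {x} {z = z} refl refl eq = +-cancelˡ-≡ x _ _ (+-cancelʳ-≡ z _ _ eq)

top-row-determines : ∀ {m m' M N} → HasLineSum m M → HasLineSum m' N →
  M 0F 0F ≡ N 0F 0F → M 0F 1F ≡ N 0F 1F → M 0F 2F ≡ N 0F 2F → M ≋ N
top-row-determines {M = M} {N} sums@(rows , cols , diag , anti) sums'@(rows' , cols' , diag' , anti') p q r
  with trans (sym (rows 0F)) (trans (cong₂ _+_ (cong₂ _+_ p q) r) (rows' 0F))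
... | refl = entrywise p q r s e t u v w
  where
  e : M 1F 1F ≡ N 1F 1F
  e = *-cancelˡ-≡ _ _ 3 (trans (magic-number M sums) (sym (magic-number N sums')))
  w : M 2F 2F ≡ N 2F 2F
  w = cancel-last p e (trans diag (sym diag'))
  u : M 2F 0F ≡ N 2F 0F
  u = cancel-last r e (trans anti (sym anti'))
  v : M 2F 1F ≡ N 2F 1F
  v = cancel-last q e (trans (cols 1F) (sym (cols' 1F)))
  s : M 1F 0F ≡ N 1F 0F
  s = cancel-middle p u (trans (cols 0F) (sym (cols' 0F)))
  t : M 1F 2F ≡ N 1F 2F
  t = cancel-middle r w (trans (cols 2F) (sym (cols' 2F)))

V : Matrix3
V = mat 1 0 2  2 1 0  0 2 1

-- Lucas's normal form: centre e = i + a + b, corners e ± a and e ± b,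
-- smallest entry i in the top middle.
lucas : ℕ → ℕ → ℕ → Matrix3
lucas i a b r c = i + a * C r c + b * V r c

C-line-sums : HasLineSum 3 C
C-line-sums =
  (λ { zero → refl ; (suc zero) → refl ; (suc (suc zero)) → refl }) ,
  (λ { zero → refl ; (suc zero) → refl ; (suc (suc zero)) → refl }) , refl , refl

V-line-sums : HasLineSum 3 V
V-line-sums =
  (λ { zero → refl ; (suc zero) → refl ; (suc (suc zero)) → refl }) ,
  (λ { zero → refl ; (suc zero) → refl ; (suc (suc zero)) → refl }) , refl , refl

span-line-sums : ∀ {X Y} i a b → HasLineSum 3 X → HasLineSum 3 Y →
  HasLineSum (3 * i + a * 3 + b * 3) (λ r c → i + a * X r c + b * Y r c)
span-line-sums i a b (rows , cols , diag , anti) (rows' , cols' , diag' , anti') =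
  (λ r → line (rows r) (rows' r)) , (λ c → line (cols c) (cols' c)) , line diag diag' , line anti anti'
  where
  collect : ∀ i a b x₁ x₂ x₃ y₁ y₂ y₃ →
    (i + a * x₁ + b * y₁) + (i + a * x₂ + b * y₂) + (i + a * x₃ + b * y₃)
      ≡ 3 * i + a * (x₁ + x₂ + x₃) + b * (y₁ + y₂ + y₃)
  collect = solve-∀
  line : ∀ {x₁ x₂ x₃ y₁ y₂ y₃} → x₁ + x₂ + x₃ ≡ 3 → y₁ + y₂ + y₃ ≡ 3 →
    (i + a * x₁ + b * y₁) + (i + a * x₂ + b * y₂) + (i + a * x₃ + b * y₃) ≡ 3 * i + a * 3 + b * 3
  line {x₁} {x₂} {x₃} {y₁} {y₂} {y₃} xs ys =
    trans (collect i a b x₁ x₂ x₃ y₁ y₂ y₃) (cong₂ (λ s t → 3 * i + a * s + b * t) xs ys)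

lucas-line-sums : ∀ i a b → HasLineSum (3 * i + a * 3 + b * 3) (lucas i a b)
lucas-line-sums i a b = span-line-sums {C} {V} i a b C-line-sums V-line-sums

-- Entries of lucas i a b written out, as the ring solver does not unfold definitions.
lucas-centre : ∀ i a b → i + a * 1 + b * 1 ≡ i + a + b
lucas-centre = solve-∀

lucas-top-middle : ∀ i a b → i + a * 0 + b * 0 ≡ i
lucas-top-middle = solve-∀

lucas-corner₀₀ : ∀ i a b → i + a * 2 + b * 1 ≡ (i + a * 1 + b * 1) + a
lucas-corner₀₀ = solve-∀

lucas-corner₀₂ : ∀ i a b → i + a * 1 + b * 2 ≡ (i + a * 1 + b * 1) + b
lucas-corner₀₂ = solve-∀

lucas-corner₂₀ : ∀ i a b → i + a * 1 + b * 1 ≡ (i + a * 1 + b * 0) + b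
lucas-corner₂₀ = solve-∀

lucas-corner₂₂ : ∀ i a b → i + a * 1 + b * 1 ≡ (i + a * 0 + b * 1) + a
lucas-corner₂₂ = solve-∀

lucas-collision : ∀ i a b → a ≡ b + b → lucas i a b 1F 0F ≡ lucas i a b 2F 0F
lucas-collision i .(b + b) b refl = collision i b
  where
  collision : ∀ i b → i + (b + b) * 0 + b * 2 ≡ i + (b + b) * 1 + b * 0
  collision = solve-∀

α β : Form → ℕ → ℕ → ℕ
α _ j k = 3 + 2 * j + k
β form₁ j _ = 1 + j
β form₂ j k = 2 + j + k

A≋1 : A ≋ λ _ _ → 1
A≋1 = entrywise refl refl refl refl refl refl refl refl refl

T₁≋3C+V : T₁ ≋ λ r c → 3 * C r c + V r c
T₁≋3C+V = entrywise refl refl refl refl refl refl refl refl refl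

B≋2C+V : B ≋ λ r c → 2 * C r c + V r c
B≋2C+V = entrywise refl refl refl refl refl refl refl refl refl

T₂≋3C+2V : T₂ ≋ λ r c → 3 * C r c + 2 * V r c
T₂≋3C+2V = entrywise refl refl refl refl refl refl refl refl refl

D≋C+V : D ≋ λ r c → C r c + V r c
D≋C+V = entrywise refl refl refl refl refl refl refl refl refl

param≋lucas : ∀ f i j k → param f i j k ≋ lucas i (α f j k) (β f j k)
param≋lucas form₁ i j k r c = begin
    T₁ r c + i * A r c + j * B r c + k * x
  ≡⟨ cong₂ (λ t s → t + i * A r c + j * s + k * x) (T₁≋3C+V r c) (B≋2C+V r c) ⟩
    (3 * x + y) + i * A r c + j * (2 * x + y) + k * x
  ≡⟨ cong (λ s → (3 * x + y) + i * s + j * (2 * x + y) + k * x) (A≋1 r c) ⟩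
    (3 * x + y) + i * 1 + j * (2 * x + y) + k * x
  ≡⟨ collect i j k x y ⟩
    i + α form₁ j k * x + β form₁ j k * y ∎
  where
  x y : ℕ
  x = C r c
  y = V r c
  collect : ∀ i j k x y →
    (3 * x + y) + i * 1 + j * (2 * x + y) + k * x ≡ i + (3 + 2 * j + k) * x + (1 + j) * y
  collect = solve-∀
param≋lucas form₂ i j k r c = begin
    T₂ r c + i * A r c + j * B r c + k * D r c
  ≡⟨ cong₂ (λ t s → t + i * A r c + j * B r c + k * s) (T₂≋3C+2V r c) (D≋C+V r c) ⟩
    (3 * x + 2 * y) + i * A r c + j * B r c + k * (x + y)
  ≡⟨ cong₂ (λ s t → (3 * x + 2 * y) + i * s + j * t + k * (x + y)) (A≋1 r c) (B≋2C+V r c) ⟩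
    (3 * x + 2 * y) + i * 1 + j * (2 * x + y) + k * (x + y)
  ≡⟨ collect i j k x y ⟩
    i + α form₂ j k * x + β form₂ j k * y ∎
  where
  x y : ℕ
  x = C r c
  y = V r c
  collect : ∀ i j k x y →
    (3 * x + 2 * y) + i * 1 + j * (2 * x + y) + k * (x + y) ≡ i + (3 + 2 * j + k) * x + (2 + j + k) * y
  collect = solve-∀

above-centre : ∀ {x y e} → x + y ≡ e + e → x ≢ e → e < x ⊎ e < y
above-centre {x} {y} {e} x+y≡e+e x≢e with <-cmp x e
... | tri< x<e _ _ = inj₂ (≰⇒> λ y≤e → <-irrefl x+y≡e+e (+-mono-<-≤ x<e y≤e))
... | tri≈ _ x≡e _ = contradiction x≡e x≢e
... | tri> _ _ e<x = inj₁ e<x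

order-pair : ∀ {A : Set} {e x y} →
  (e < y → y < x → A) → (e < x → x < y → A) → e < x → e < y → x ≢ y → A
order-pair {x = x} {y} y<x-case x<y-case e<x e<y x≢y with <-cmp x y
... | tri< x<y _ _ = x<y-case e<x x<y
... | tri≈ _ x≡y _ = contradiction x≡y x≢y
... | tri> _ _ y<x = y<x-case e<y y<x

Normalised : Matrix3 → Set
Normalised N = N 1F 1F < N 0F 2F × N 0F 2F < N 0F 0F

normalising-symmetry : ∀ {m M} → Distinct M → HasLineSum m M → Σ D4 λ g → Normalised (g • M)
normalising-symmetry {M = M} distinct sums@(_ , _ , diag , anti) =
  choose (above-centre (opposite-cells p e w diag (magic-number M sums)) (≢-row distinct λ ()))
         (above-centre (opposite-cells r e u anti (magic-number M sums)) (≢-row distinct λ ()))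
  where
  e p r u w : ℕ
  e = M 1F 1F
  p = M 0F 0F
  r = M 0F 2F
  u = M 2F 0F
  w = M 2F 2F
  by : ∀ g → (g • M) 1F 1F < (g • M) 0F 2F → (g • M) 0F 2F < (g • M) 0F 0F →
       Σ D4 λ g → Normalised (g • M)
  by g e<y y<x = g , e<y , y<x
  choose : e < p ⊎ e < w → e < r ⊎ e < u → Σ D4 λ g → Normalised (g • M)
  choose (inj₁ e<p) (inj₁ e<r) =
    order-pair (by (false , false , false)) (by (false , false , true)) e<p e<r (≢-col distinct λ ())
  choose (inj₁ e<p) (inj₂ e<u) =
    order-pair (by (true , false , false)) (by (true , true , false)) e<p e<u (≢-row distinct λ ())
  choose (inj₂ e<w) (inj₁ e<r) =
    order-pair (by (true , true , true)) (by (true , false , true)) e<w e<r (≢-row distinct λ ())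
  choose (inj₂ e<w) (inj₂ e<u) =
    order-pair (by (false , true , true)) (by (false , true , false)) e<w e<u (≢-col distinct λ ())

normalised⇒lucas : ∀ {m N} → HasLineSum m N → Normalised N →
  N ≋ lucas (N 0F 1F) (N 0F 0F ∸ N 1F 1F) (N 0F 2F ∸ N 1F 1F)
normalised⇒lucas {m} {N} sums@(rows , _) (e<r , r<p) =
  top-row-determines sums (lucas-line-sums q a b) p≡ (sym (lucas-top-middle q a b)) r≡
  where
  e p q r a b : ℕ
  e = N 1F 1F
  p = N 0F 0F
  q = N 0F 1F
  r = N 0F 2F
  a = p ∸ e
  b = r ∸ e
  e+a≡p : e + a ≡ p
  e+a≡p = m+[n∸m]≡n (<⇒≤ (<-trans e<r r<p))
  e+b≡r : e + b ≡ r
  e+b≡r = m+[n∸m]≡n (<⇒≤ e<r)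
  regroup : ∀ e a q b → e + e + (q + a + b) ≡ (e + a) + q + (e + b)
  regroup = solve-∀
  triple : ∀ e → 3 * e ≡ e + e + e
  triple = solve-∀
  e≡centre : e ≡ lucas q a b 1F 1F
  e≡centre = sym (trans (lucas-centre q a b) (+-cancelˡ-≡ (e + e) _ _ (begin
    e + e + (q + a + b)     ≡⟨ regroup e a q b ⟩
    (e + a) + q + (e + b)   ≡⟨ cong₂ (λ s t → s + q + t) e+a≡p e+b≡r ⟩
    p + q + r               ≡⟨ rows 0F ⟩
    m                       ≡⟨ sym (magic-number N sums) ⟩
    3 * e                   ≡⟨ triple e ⟩
    e + e + e               ∎)))
  p≡ : p ≡ lucas q a b 0F 0F
  p≡ = trans (sym e+a≡p) (trans (cong (_+ a) e≡centre) (sym (lucas-corner₀₀ q a b)))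
  r≡ : r ≡ lucas q a b 0F 2F
  r≡ = trans (sym e+b≡r) (trans (cong (_+ b) e≡centre) (sym (lucas-corner₀₂ q a b)))

LucasNormalForm : Matrix3 → Set
LucasNormalForm M =
  Σ D4 λ g → Σ ℕ λ i → Σ ℕ λ a → Σ ℕ λ b → 0 < b × b < a × a ≢ b + b × M ≋ (g • lucas i a b)

lucas-normal-form : ∀ {M} → IsMagic M → LucasNormalForm M
lucas-normal-form {M} magic@(distinct , _ , sums) with normalising-symmetry distinct sums
... | g , normalised@(e<r , r<p) with IsMagic-• g magic
...   | distinct' , _ , sums' =
  g ⁻¹ , i , a , b , m<n⇒0<n∸m e<r , ∸-monoˡ-< r<p (<⇒≤ e<r) , a≢b+b ,
  ≋-trans (•-inverseˡ g M) (•-cong (g ⁻¹) N≋lucas)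
  where
  N : Matrix3
  N = g • M
  i a b : ℕ
  i = N 0F 1F
  a = N 0F 0F ∸ N 1F 1F
  b = N 0F 2F ∸ N 1F 1F
  N≋lucas : N ≋ lucas i a b
  N≋lucas = normalised⇒lucas sums' normalised
  a≢b+b : a ≢ b + b
  a≢b+b a≡b+b = ≢-row distinct' (λ ())
    (trans (N≋lucas 1F 0F) (trans (lucas-collision i a b a≡b+b) (sym (N≋lucas 2F 0F))))

deviation : Matrix3 → Fin 3 → Fin 3 → ℕ
deviation M r c = ∣ M r c - M 1F 1F ∣

deviation-above : ∀ {x y d} → y ≡ x + d → ∣ y - x ∣ ≡ d
deviation-above {x} {d = d} refl = trans (∣-∣-comm (x + d) x) (∣m-m+n∣≡n x d)

deviation-below : ∀ {x y d} → x ≡ y + d → ∣ y - x ∣ ≡ d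
deviation-below {y = y} {d} refl = ∣m-m+n∣≡n y d

sorted : ℕ × ℕ → ℕ × ℕ
sorted (x , y) = x ⊔ y , x ⊓ y

-- A D4-invariant of squares whose opposite corners deviate equally from the centre.
profile : Matrix3 → ℕ × ℕ × ℕ
profile M = M 1F 1F , sorted (deviation M 0F 0F , deviation M 0F 2F)

profile-cong : ∀ {M N} → M ≋ N → profile M ≡ profile N
profile-cong M≋N rewrite M≋N 0F 0F | M≋N 0F 2F | M≋N 1F 1F = refl

top-deviations-• : ∀ g {X a b} →
  deviation X 0F 0F ≡ a → deviation X 0F 2F ≡ b → deviation X 2F 0F ≡ b → deviation X 2F 2F ≡ a →
  (deviation (g • X) 0F 0F , deviation (g • X) 0F 2F) ≡ (a , b) ⊎
  (deviation (g • X) 0F 0F , deviation (g • X) 0F 2F) ≡ (b , a)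
top-deviations-• (false , false , false) p r u w = inj₁ (cong₂ _,_ p r)
top-deviations-• (false , false , true)  p r u w = inj₂ (cong₂ _,_ r p)
top-deviations-• (false , true  , false) p r u w = inj₂ (cong₂ _,_ u w)
top-deviations-• (false , true  , true)  p r u w = inj₁ (cong₂ _,_ w u)
top-deviations-• (true  , false , false) p r u w = inj₁ (cong₂ _,_ p u)
top-deviations-• (true  , true  , false) p r u w = inj₂ (cong₂ _,_ u p)
top-deviations-• (true  , false , true)  p r u w = inj₂ (cong₂ _,_ r w)
top-deviations-• (true  , true  , true)  p r u w = inj₁ (cong₂ _,_ w r)

profile-• : ∀ g {X a b} → b ≤ a →
  deviation X 0F 0F ≡ a → deviation X 0F 2F ≡ b → deviation X 2F 0F ≡ b → deviation X 2F 2F ≡ a →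
  profile (g • X) ≡ (X 1F 1F , a , b)
profile-• g b≤a p r u w with top-deviations-• g p r u w
... | inj₁ eq =
  cong₂ _,_ (centre-• g) (trans (cong sorted eq) (cong₂ _,_ (m≥n⇒m⊔n≡m b≤a) (m≥n⇒m⊓n≡n b≤a)))
... | inj₂ eq =
  cong₂ _,_ (centre-• g) (trans (cong sorted eq) (cong₂ _,_ (m≤n⇒m⊔n≡n b≤a) (m≤n⇒m⊓n≡m b≤a)))

lucas-profile : ∀ g i a b → b ≤ a → profile (g • lucas i a b) ≡ (i + a + b , a , b)
lucas-profile g i a b b≤a =
  trans (profile-• g b≤a (deviation-above (lucas-corner₀₀ i a b)) (deviation-above (lucas-corner₀₂ i a b))
                         (deviation-below (lucas-corner₂₀ i a b)) (deviation-below (lucas-corner₂₂ i a b)))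
        (cong (_, a , b) (lucas-centre i a b))

lucas-unique : ∀ {M g g' i a b i' a' b'} → b ≤ a → b' ≤ a' →
  M ≋ (g • lucas i a b) → M ≋ (g' • lucas i' a' b') → i ≡ i' × a ≡ a' × b ≡ b'
lucas-unique {M} {g} {g'} {i} {a} {b} {i'} {a'} {b'} b≤a b'≤a' M≋ M≋' with ,-injective (begin
    (i + a + b , a , b)             ≡⟨ sym (lucas-profile g i a b b≤a) ⟩
    profile (g • lucas i a b)       ≡⟨ sym (profile-cong M≋) ⟩
    profile M                       ≡⟨ profile-cong M≋' ⟩
    profile (g' • lucas i' a' b')   ≡⟨ lucas-profile g' i' a' b' b'≤a' ⟩
    (i' + a' + b' , a' , b')        ∎)
... | centres , refl = +-cancelʳ-≡ a i i' (+-cancelʳ-≡ b _ _ centres) , refl , refl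

α≡1+β+β+k : ∀ j k → 3 + 2 * j + k ≡ 1 + ((1 + j) + (1 + j)) + k
α≡1+β+β+k = solve-∀

α≡β+1+j : ∀ j k → 3 + 2 * j + k ≡ (2 + j + k) + (1 + j)
α≡β+1+j = solve-∀

β+β≡1+α+k : ∀ j k → (2 + j + k) + (2 + j + k) ≡ 1 + (3 + 2 * j + k) + k
β+β≡1+α+k = solve-∀

form₁-gap : ∀ j k → β form₁ j k + β form₁ j k < α form₁ j k
form₁-gap j k = ≤-trans (m≤m+n _ k) (≤-reflexive (sym (α≡1+β+β+k j k)))

form₂-gap : ∀ j k → α form₂ j k < β form₂ j k + β form₂ j k
form₂-gap j k = ≤-trans (m≤m+n _ k) (≤-reflexive (sym (β+β≡1+α+k j k)))

β<α : ∀ f j k → β f j k < α f j k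
β<α form₁ j k = ≤-<-trans (m≤m+n (1 + j) (1 + j)) (form₁-gap j k)
β<α form₂ j k = <-≤-trans (m<m+n (2 + j + k) z<s) (≤-reflexive (sym (α≡β+1+j j k)))

form₁-surjective : ∀ {a b} → 0 < b → b + b < a →
  Σ ℕ λ j → Σ ℕ λ k → α form₁ j k ≡ a × β form₁ j k ≡ b
form₁-surjective {b = suc j} _ b+b<a with m≤n⇒∃[o]m+o≡n b+b<a
... | k , 1+b+b+k≡a = j , k , trans (α≡1+β+β+k j k) 1+b+b+k≡a , refl

form₂-surjective : ∀ {a b} → b < a → a < b + b →
  Σ ℕ λ j → Σ ℕ λ k → α form₂ j k ≡ a × β form₂ j k ≡ b
form₂-surjective {a} {b} b<a a<b+b with m≤n⇒∃[o]m+o≡n b<a | m≤n⇒∃[o]m+o≡n a<b+b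
... | j , 1+b+j≡a | k , 1+a+k≡b+b = j , k , α≡a , β≡b
  where
  regroup : ∀ b j k → b + (2 + j + k) ≡ 1 + (1 + b + j) + k
  regroup = solve-∀
  β≡b : 2 + j + k ≡ b
  β≡b = +-cancelˡ-≡ b _ _ (begin
    b + (2 + j + k)       ≡⟨ regroup b j k ⟩
    1 + (1 + b + j) + k   ≡⟨ cong (λ x → 1 + x + k) 1+b+j≡a ⟩
    1 + a + k             ≡⟨ 1+a+k≡b+b ⟩
    b + b                 ∎)
  α≡a : 3 + 2 * j + k ≡ a
  α≡a = begin
    3 + 2 * j + k         ≡⟨ α≡β+1+j j k ⟩
    (2 + j + k) + (1 + j) ≡⟨ cong (_+ (1 + j)) β≡b ⟩
    b + (1 + j)           ≡⟨ trans (+-suc b j) 1+b+j≡a ⟩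
    a                     ∎

α-β-surjective : ∀ {a b} → 0 < b → b < a → a ≢ b + b →
  Σ Form λ f → Σ ℕ λ j → Σ ℕ λ k → α f j k ≡ a × β f j k ≡ b
α-β-surjective {a} {b} 0<b b<a a≢b+b with <-cmp (b + b) a
... | tri< b+b<a _ _ = form₁ , form₁-surjective 0<b b+b<a
... | tri≈ _ b+b≡a _ = contradiction (sym b+b≡a) a≢b+b
... | tri> _ _ a<b+b = form₂ , form₂-surjective b<a a<b+b

forms-separated : ∀ j k j' k' → β form₁ j k ≡ β form₂ j' k' → α form₁ j k ≢ α form₂ j' k'
forms-separated j k j' k' β≡ α≡ = <-irrefl (cong₂ _+_ β≡ β≡) (<-trans (form₁-gap j k) α₁<β₂+β₂)
  where
  α₁<β₂+β₂ : α form₁ j k < β form₂ j' k' + β form₂ j' k'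
  α₁<β₂+β₂ = subst (_< β form₂ j' k' + β form₂ j' k') (sym α≡) (form₂-gap j' k')

α-β-injective : ∀ {f j k f' j' k'} → α f j k ≡ α f' j' k' → β f j k ≡ β f' j' k' →
  f ≡ f' × j ≡ j' × k ≡ k'
α-β-injective {form₁} {j} {f' = form₁} α≡ refl = refl , refl , +-cancelˡ-≡ (3 + 2 * j) _ _ α≡
α-β-injective {form₁} {j} {k} {form₂} {j'} {k'} α≡ β≡ =
  contradiction α≡ (forms-separated j k j' k' β≡)
α-β-injective {form₂} {j} {k} {form₁} {j'} {k'} α≡ β≡ =
  contradiction (sym α≡) (forms-separated j' k' j k (sym β≡))
α-β-injective {form₂} {j} {k} {form₂} {j'} {k'} α≡ β≡
  with suc-injective (+-cancelˡ-≡ (2 + j + k) (1 + j) (1 + j') (begin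
    (2 + j + k) + (1 + j)     ≡⟨ sym (α≡β+1+j j k) ⟩
    α form₂ j k               ≡⟨ α≡ ⟩
    α form₂ j' k'             ≡⟨ α≡β+1+j j' k' ⟩
    (2 + j' + k') + (1 + j')  ≡⟨ cong (_+ (1 + j')) (sym β≡) ⟩
    (2 + j + k) + (1 + j')    ∎))
... | refl = refl , refl , +-cancelˡ-≡ (2 + j) _ _ β≡

lucas⇒represents : ∀ {M} g f i j k → M ≋ (g • lucas i (α f j k) (β f j k)) → Represents M f i j k
lucas⇒represents g f i j k M≋lucas = g , ≋-trans M≋lucas (•-cong g (≋-sym (param≋lucas f i j k)))

representation-unique : ∀ {M} g f i j k → M ≋ (g • lucas i (α f j k) (β f j k)) →
  (f' : Form) (i' j' k' : ℕ) → Represents M f' i' j' k' → (f ≡ f') × (i ≡ i') × (j ≡ j') × (k ≡ k')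
representation-unique g f i j k M≋lucas f' i' j' k' (g' , M≋param') =
  conclude (lucas-unique {g = g} {g'} (<⇒≤ (β<α f j k)) (<⇒≤ (β<α f' j' k')) M≋lucas
                         (≋-trans M≋param' (•-cong g' (param≋lucas f' i' j' k'))))
  where
  conclude : i ≡ i' × α f j k ≡ α f' j' k' × β f j k ≡ β f' j' k' →
    (f ≡ f') × (i ≡ i') × (j ≡ j') × (k ≡ k')
  conclude (i≡i' , α≡ , β≡) with α-β-injective α≡ β≡
  ... | f≡f' , j≡j' , k≡k' = f≡f' , i≡i' , j≡j' , k≡k'

UniquelyRepresented : Matrix3 → Set
UniquelyRepresented M =
  Σ Form λ f → Σ ℕ λ i → Σ ℕ λ j → Σ ℕ λ k → Represents M f i j k ×
    ((f' : Form) (i' j' k' : ℕ) → Represents M f' i' j' k' →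
      (f ≡ f') × (i ≡ i') × (j ≡ j') × (k ≡ k'))

normal-form⇒uniquely-represented : ∀ {M} → LucasNormalForm M → UniquelyRepresented M
normal-form⇒uniquely-represented (g , i , a , b , 0<b , b<a , a≢b+b , M≋lucas)
  with α-β-surjective 0<b b<a a≢b+b
... | f , j , k , refl , refl =
  f , i , j , k , lucas⇒represents g f i j k M≋lucas , representation-unique g f i j k M≋lucas

theorem2p1 : (M : Defs.Matrix3) → IsMagic M →
    Σ Form λ f → Σ ℕ λ i → Σ ℕ λ j → Σ ℕ λ k →
      Represents M f i j k ×
      ((f' : Form) (i' j' k' : ℕ) → Represents M f' i' j' k' →
        (f ≡ f') × (i ≡ i') × (j ≡ j') × (k ≡ k'))
theorem2p1 M magic = normal-form⇒uniquely-represented (lucas-normal-form magic)
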